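{- Let $G=(V,E)$ be a hedgegraph with connectivity $\lambda>0$ and weak partition connectivity $\mathrm{WPC}_G$. Then $\lfloor \lambda/2\rfloor\le \mathrm{WPC}_G\le\lambda$.
   Context: A hedgegraph $G=(V,E)$ consists of a finite vertex set $V$ and a finite set $E$ of hedges; each hedge is a set of hyperedges (subsets of $V$), the hyperedges within one hedge are pairwise vertex-disjoint, and no hyperedge belongs to two hedges. For $S\subseteq V$, $\delta(S)$ is the set of hedges containing a hyperedge $h$ with $h\cap S\ne\emptyset$ and $h\setminus S\ne\emptyset$; the connectivity is $\lambda=\min\{|\delta(S)|:\emptyset\ne S\subsetneq V\}$. For a partition $\mathcal{P}$ of $V$ into nonempty parts and a hedge $e$, $\mathcal{P}(e)$ is the hedgegraph obtained from $(V,\{e\})$ by contracting each part of $\mathcal{P}$ to a single vertex (so it has $|\mathcal{P}|$ vertices), and $\#\mathrm{Comps}(\mathcal{P}(e))$ is its number of connected components (components of the hypergraph formed by all its hyperedges). The weak partition connectivity is $\mathrm{WPC}_G=\min_{\mathcal{P}}\left\lfloor \frac{\sum_{e\in E}(|\mathcal{P}|-\#\mathrm{Comps}(\mathcal{P}(e)))}{|\mathcal{P}|-1}\right\rfloor$ over partitions $\mathcal{P}$ of $V$ (with $0/0=+\infty$). -}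

module Defs where

open import Data.Nat using (ℕ; zero; suc; _+_; _∸_; _≤_; _<_)
open import Data.Nat.DivMod using (_/_)
open import Data.Bool using (Bool; true; false; _∧_; not)
open import Data.Fin using (Fin; _≟_)
open import Data.List using (List; length; filter; lookup; map; allFin)
open import Data.Bool.ListAction using (any)
open import Data.Nat.ListAction using (sum)
open import Data.List.Membership.Propositional using (_∈_)
open import Data.Product using (Σ; _×_; ∃; ∃-syntax)
open import Function.Definitions using (Surjective)
open import Relation.Binary.PropositionalEquality using (_≡_)
open import Relation.Nullary using (¬_)
open import Relation.Nullary.Decidable using (⌊_⌋)

Hyperedge : ℕ → Set
Hyperedge n = Fin n → Bool

Hedge : ℕ → Set
Hedge n = List (Hyperedge n)

Hedgegraph : ℕ → Set
Hedgegraph n = List (Hedge n)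

anyV : ∀ {n} → (Fin n → Bool) → Bool
anyV {n} f = any f (allFin n)

IsHedgegraph : ∀ {n} → Hedgegraph n → Set
IsHedgegraph {n} E =
  (∀ (a : Fin (length E)) (i j : Fin (length (lookup E a))) → ¬ (i ≡ j) →
     ∀ (v : Fin n) → ¬ ((lookup (lookup E a) i v ≡ true) × (lookup (lookup E a) j v ≡ true)))
  × (∀ (a b : Fin (length E)) → ¬ (a ≡ b) →
     ∀ (i : Fin (length (lookup E a))) (j : Fin (length (lookup E b))) →
       ¬ (∀ (v : Fin n) → lookup (lookup E a) i v ≡ lookup (lookup E b) j v))

crosses : ∀ {n} → (S : Fin n → Bool) → Hyperedge n → Bool
crosses S h = anyV (λ v → h v ∧ S v) ∧ anyV (λ v → h v ∧ not (S v))

inCut : ∀ {n} → (S : Fin n → Bool) → Hedge n → Bool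
inCut S e = any (crosses S) e

cutSize : ∀ {n} → Hedgegraph n → (Fin n → Bool) → ℕ
cutSize E S = length (filter (λ e → inCut S e ≡? true) E)
  where
  open import Data.Bool.Properties using () renaming (_≟_ to _≡?_)

NonemptyProper : ∀ {n} → (Fin n → Bool) → Set
NonemptyProper S = (∃[ v ] S v ≡ true) × (∃[ u ] S u ≡ false)

IsConnectivity : ∀ {n} → Hedgegraph n → ℕ → Set
IsConnectivity E l =
  (∃[ S ] (NonemptyProper S × cutSize E S ≡ l))
  × (∀ S → NonemptyProper S → l ≤ cutSize E S)

-- A partition of V into k nonempty parts, given by a surjective labelling p : Fin n → Fin k.
-- The image of a hyperedge h in the contracted hedgegraph: the set of parts meeting h.
contractEdge : ∀ {n k} → (Fin n → Fin k) → Hyperedge n → Hyperedge k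
contractEdge p h i = anyV (λ v → h v ∧ ⌊ p v ≟ i ⌋)

contract : ∀ {n k} → (Fin n → Fin k) → Hedge n → Hedge k
contract p e = map (contractEdge p) e

data Conn {k : ℕ} (H : List (Hyperedge k)) (i : Fin k) : Fin k → Set where
  conn-refl : Conn H i i
  conn-step : ∀ {j l h} → Conn H i j → h ∈ H → h j ≡ true → h l ≡ true → Conn H i l

NumComps : ∀ {k} → List (Hyperedge k) → ℕ → Set
NumComps {k} H c =
  Σ (Fin k → Fin c) λ f → Surjective _≡_ _≡_ f
    × (∀ i j → (f i ≡ f j → Conn H i j) × (Conn H i j → f i ≡ f j))

sumFin : ∀ {m} → (Fin m → ℕ) → ℕ
sumFin {m} f = sum (map f (allFin m))

-- For a partition p into k = m + 2 ≥ 2 parts (so k - 1 = m + 1), the value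
--   ⌊ Σ_e (k - #Comps(P(e))) / (k - 1) ⌋ ;
-- partitions with k = 1 give 0/0 = +∞ and never attain the minimum, so they are omitted.
PartitionValue : ∀ {n} → Hedgegraph n → ℕ → Set
PartitionValue {n} E w =
  Σ ℕ λ m → Σ (Fin n → Fin (suc (suc m))) λ p → Surjective _≡_ _≡_ p
    × Σ (Fin (length E) → ℕ) λ cs →
        (∀ a → NumComps (contract p (lookup E a)) (cs a))
        × w ≡ sumFin (λ a → suc (suc m) ∸ cs a) / suc m

IsWPC : ∀ {n} → Hedgegraph n → ℕ → Set
IsWPC E w = PartitionValue E w × (∀ w' → PartitionValue E w' → w ≤ w')

-- Upper bound: a minimum cut δ(S) yields the two-part partition {S, V ∖ S}, whose value is
-- exactly |δ(S)|, since a hedge leaves one component after contraction iff it lies in δ(S).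
--
-- Lower bound: for a partition P into k parts, every part Pᵢ is a nonempty proper set, so
-- k λ ≤ Σᵢ |δ(Pᵢ)| = Σₑ #{i : e ∈ δ(Pᵢ)}.  In the contracted hypergraph P(e), every part i
-- with e ∈ δ(Pᵢ) shares a hyperedge with another part, so it lies in a component with at least
-- two vertices; a component of size N containing t such parts satisfies 2 + t ≤ 2N, and
-- summing over the components gives #{i : e ∈ δ(Pᵢ)} ≤ 2 (k − #Comps(P(e))).  Hence
-- k λ ≤ 2 Σₑ (k − #Comps(P(e))), and ⌊λ/2⌋ (k − 1) is at most that sum.
module Submission where

open import Defs
open import Data.Nat using (ℕ; zero; suc; _+_; _*_; _∸_; _≤_; _<_; z≤n)
open import Data.Nat.DivMod using (_/_; m/n*n≤m; m*n/n≡m; /-monoˡ-≤; n/1≡n)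
open import Data.Product using (_×_; ∃-syntax; _,_; proj₁; proj₂; map₂)

open import Data.Nat.Properties
  using (≤-refl; ≤-reflexive; ≤-trans; +-mono-≤; +-monoʳ-≤; *-monoʳ-≤; *-monoˡ-≤;
         +-comm; +-identityʳ; *-comm; *-assoc; *-identityʳ; *-distribˡ-∸; m≤m+n; n≤1+n;
         m+n≤o⇒m≤o∸n; *-cancelˡ-≤; +-*-semiring; module ≤-Reasoning)
open import Algebra.Properties.Semiring.Sum +-*-semiring
  using (sum; sum-syntax; sum-cong-≗; sum-remove; sum-replicate-zero; ∑-comm; ∑-distrib-+;
         *-distribˡ-sum; *-distribʳ-sum)
open import Data.Bool using (Bool; true; false; _∧_; not; if_then_else_)
open import Data.Bool.ListAction using (any; or)
open import Data.Bool.Properties as Bool using (T-≡)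
open import Data.Empty using (⊥; ⊥-elim)
open import Data.Fin using (Fin; zero; suc; _≟_; punchIn; punchOut)
open import Data.Fin.Properties using (punchInᵢ≢i; punchIn-punchOut; any?)
open import Data.List using (List; []; _∷_; length; lookup; allFin; tabulate)
open import Data.List.Membership.Propositional using (_∈_; find; lose)
open import Data.List.Membership.Propositional.Properties using (∈-allFin; ∈-map⁺)
open import Data.List.Properties using (map-tabulate; map-cong; map-∘)
open import Data.List.Relation.Unary.Any.Properties using (any⁺; any⁻)
import Data.Nat.ListAction as ListAction
open import Function using (_∘_; id; Equivalence)
open import Function.Definitions using (Surjective)
open import Relation.Binary.PropositionalEquality
  using (_≡_; _≢_; refl; sym; trans; cong; cong₂; subst; _≗_; module ≡-Reasoning)
open import Relation.Nullary using (¬_; yes; no)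
open import Relation.Nullary.Decidable
  using (Dec; ⌊_⌋; isYes≗does; dec-true; dec-false; toWitness; toWitnessFalse; _×-dec_)

open Equivalence using (to; from)

sum-tabulate : ∀ {m} (g : Fin m → ℕ) → ListAction.sum (tabulate g) ≡ ∑[ i < m ] g i
sum-tabulate {zero} g = refl
sum-tabulate {suc m} g = cong (g zero +_) (sum-tabulate (g ∘ suc))

sumFin≡∑ : ∀ {m} (f : Fin m → ℕ) → sumFin f ≡ ∑[ i < m ] f i
sumFin≡∑ {m} f = trans (cong ListAction.sum (map-tabulate id f)) (sum-tabulate f)

∑-const : ∀ m c → ∑[ i < m ] c ≡ m * c
∑-const zero c = refl
∑-const (suc m) c = cong (c +_) (∑-const m c)

∑-mono-≤ : ∀ {m} {f g : Fin m → ℕ} → (∀ i → f i ≤ g i) → ∑[ i < m ] f i ≤ ∑[ i < m ] g i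
∑-mono-≤ {zero} f≤g = z≤n
∑-mono-≤ {suc m} f≤g = +-mono-≤ (f≤g zero) (∑-mono-≤ (f≤g ∘ suc))

term≤∑ : ∀ {m} (f : Fin m → ℕ) i → f i ≤ ∑[ j < m ] f j
term≤∑ {suc m} f i = ≤-trans (m≤m+n (f i) _) (≤-reflexive (sym (sum-remove {i = i} f)))

term+term≤∑ : ∀ {m} (f : Fin m → ℕ) {i j} → i ≢ j → f i + f j ≤ ∑[ l < m ] f l
term+term≤∑ {suc m} f {i} {j} i≢j = begin
  f i + f j                                   ≡⟨ cong (λ l → f i + f l) (punchIn-punchOut i≢j) ⟨
  f i + f (punchIn i (punchOut i≢j))          ≤⟨ +-monoʳ-≤ (f i) (term≤∑ (f ∘ punchIn i) _) ⟩
  f i + ∑[ l < m ] f (punchIn i l)            ≡⟨ sum-remove f ⟨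
  ∑[ l < suc m ] f l                          ∎
  where open ≤-Reasoning

⌊⌋-yes : ∀ {A : Set} (a? : Dec A) → A → ⌊ a? ⌋ ≡ true
⌊⌋-yes a? a = trans (isYes≗does a?) (dec-true a? a)

⌊⌋-no : ∀ {A : Set} (a? : Dec A) → ¬ A → ⌊ a? ⌋ ≡ false
⌊⌋-no a? ¬a = trans (isYes≗does a?) (dec-false a? ¬a)

𝟙 : Bool → ℕ
𝟙 true = 1
𝟙 false = 0

𝟙≤1 : ∀ b → 𝟙 b ≤ 1
𝟙≤1 true = ≤-refl
𝟙≤1 false = z≤n

𝟙-≢true : ∀ {b} → b ≢ true → 𝟙 b ≡ 0
𝟙-≢true {true} b≢true = ⊥-elim (b≢true refl)
𝟙-≢true {false} _ = refl

∑-𝟙-≟ : ∀ {c} (y : Fin c) → ∑[ x < c ] 𝟙 ⌊ y ≟ x ⌋ ≡ 1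
∑-𝟙-≟ {suc c} y = begin
  ∑[ x < suc c ] 𝟙 ⌊ y ≟ x ⌋                          ≡⟨ sum-remove {i = y} (λ x → 𝟙 ⌊ y ≟ x ⌋) ⟩
  𝟙 ⌊ y ≟ y ⌋ + ∑[ x < c ] 𝟙 ⌊ y ≟ punchIn y x ⌋      ≡⟨ cong₂ _+_ (cong 𝟙 (⌊⌋-yes (y ≟ y) refl))
                                                                   (sum-cong-≗ y≢punchIn) ⟩
  1 + ∑[ x < c ] 0                                     ≡⟨ cong suc (sum-replicate-zero c) ⟩
  1                                                    ∎
  where
  open ≡-Reasoning
  y≢punchIn : ∀ x → 𝟙 ⌊ y ≟ punchIn y x ⌋ ≡ 0
  y≢punchIn x = cong 𝟙 (⌊⌋-no (y ≟ punchIn y x) (punchInᵢ≢i y x ∘ sym))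

module Fibres {k c} (f : Fin k → Fin c) where

  inFibre : Fin c → Fin k → ℕ
  inFibre x i = 𝟙 ⌊ f i ≟ x ⌋

  fibreSum : (Fin k → ℕ) → Fin c → ℕ
  fibreSum g x = ∑[ i < k ] (inFibre x i * g i)

  ∑-fibreSum : (g : Fin k → ℕ) → ∑[ x < c ] fibreSum g x ≡ ∑[ i < k ] g i
  ∑-fibreSum g = begin
    ∑[ x < c ] ∑[ i < k ] (inFibre x i * g i)    ≡⟨ ∑-comm (λ x i → inFibre x i * g i) ⟩
    ∑[ i < k ] ∑[ x < c ] (inFibre x i * g i)    ≡⟨ sum-cong-≗ pull-out ⟨
    ∑[ i < k ] ((∑[ x < c ] inFibre x i) * g i)  ≡⟨ sum-cong-≗ (λ i → cong (_* g i) (∑-𝟙-≟ (f i))) ⟩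
    ∑[ i < k ] (g i + 0)                         ≡⟨ sum-cong-≗ (λ i → +-identityʳ (g i)) ⟩
    ∑[ i < k ] g i                               ∎
    where
    open ≡-Reasoning
    pull-out : ∀ i → (∑[ x < c ] inFibre x i) * g i ≡ ∑[ x < c ] (inFibre x i * g i)
    pull-out i = *-distribʳ-sum (g i) (λ x → inFibre x i)

  fibreSum-mono : ∀ {g g′ : Fin k → ℕ} → (∀ i → g i ≤ g′ i) → ∀ x → fibreSum g x ≤ fibreSum g′ x
  fibreSum-mono g≤g′ x = ∑-mono-≤ (λ i → *-monoʳ-≤ (inFibre x i) (g≤g′ i))

  fibreSum-term : (g : Fin k → ℕ) → ∀ {i x} → f i ≡ x → inFibre x i * g i ≡ g i
  fibreSum-term g {i} {x} fi≡x rewrite ⌊⌋-yes (f i ≟ x) fi≡x = +-identityʳ (g i)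

  fibreSum-pair : (g : Fin k → ℕ) → ∀ {i j x} → i ≢ j → f i ≡ x → f j ≡ x → g i + g j ≤ fibreSum g x
  fibreSum-pair g {i} {j} {x} i≢j fi≡x fj≡x =
    subst (_≤ fibreSum g x) (cong₂ _+_ (fibreSum-term g {i} fi≡x) (fibreSum-term g {j} fj≡x))
      (term+term≤∑ (λ l → inFibre x l * g l) i≢j)

  fibreSum-member : (g : Fin k → ℕ) → ∀ {i x} → f i ≡ x → g i ≤ fibreSum g x
  fibreSum-member g {i} {x} fi≡x =
    subst (_≤ fibreSum g x) (fibreSum-term g {i} fi≡x) (term≤∑ (λ l → inFibre x l * g l) i)

  fibreSum-zero : (g : Fin k → ℕ) → ∀ {x} → (∀ i → f i ≡ x → g i ≡ 0) → fibreSum g x ≡ 0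
  fibreSum-zero g {x} g≡0 = trans (sum-cong-≗ term≡0) (sum-replicate-zero k)
    where
    term≡0 : ∀ i → inFibre x i * g i ≡ 0
    term≡0 i with f i ≟ x
    ... | yes fi≡x = cong (_+ 0) (g≡0 i fi≡x)
    ... | no _ = refl

∧-true⁺ : ∀ {a b} → a ≡ true → b ≡ true → a ∧ b ≡ true
∧-true⁺ refl refl = refl

∧-true⁻ : ∀ {a b} → a ∧ b ≡ true → a ≡ true × b ≡ true
∧-true⁻ {true} {true} _ = refl , refl

any-true⁺ : ∀ {A : Set} (p : A → Bool) {xs x} → x ∈ xs → p x ≡ true → any p xs ≡ true
any-true⁺ p x∈xs px = to T-≡ (any⁺ p (lose x∈xs (from T-≡ px)))

any-true⁻ : ∀ {A : Set} (p : A → Bool) xs → any p xs ≡ true → ∃[ x ] (x ∈ xs × p x ≡ true)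
any-true⁻ p xs any≡true = map₂ (map₂ (to T-≡)) (find (any⁻ p xs (from T-≡ any≡true)))

anyV-true⁺ : ∀ {n} (f : Fin n → Bool) {v} → f v ≡ true → anyV f ≡ true
anyV-true⁺ f {v} = any-true⁺ f (∈-allFin v)

anyV-true⁻ : ∀ {n} (f : Fin n → Bool) → anyV f ≡ true → ∃[ v ] f v ≡ true
anyV-true⁻ {n} f anyV≡true = map₂ proj₂ (any-true⁻ f (allFin n) anyV≡true)

anyV-cong : ∀ {n} {f g : Fin n → Bool} → f ≗ g → anyV f ≡ anyV g
anyV-cong {n} f≗g = cong or (map-cong f≗g (allFin n))

contractEdge-true : ∀ {n k} (p : Fin n → Fin k) h {v x} → h v ≡ true → p v ≡ x →
  contractEdge p h x ≡ true
contractEdge-true p h {v} {x} hv pv≡x =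
  anyV-true⁺ (λ u → h u ∧ ⌊ p u ≟ x ⌋) (∧-true⁺ hv (⌊⌋-yes (p v ≟ x) pv≡x))

cutSize≡∑ : ∀ {n} (E : Hedgegraph n) S → cutSize E S ≡ ∑[ a < length E ] 𝟙 (inCut S (lookup E a))
cutSize≡∑ [] S = refl
cutSize≡∑ (e ∷ E) S with inCut S e
... | true = cong suc (cutSize≡∑ E S)
... | false = cutSize≡∑ E S

NonIsolated : ∀ {k} → List (Hyperedge k) → Fin k → Set
NonIsolated H i = ∃[ j ] ∃[ h ] (h ∈ H × h i ≡ true × h j ≡ true × i ≢ j)

nonIsolated-count : ∀ {k c} (H : List (Hyperedge k)) → NumComps H c → (T : Fin k → Bool) →
  (∀ i → T i ≡ true → NonIsolated H i) → ∑[ i < k ] 𝟙 (T i) + 2 * c ≤ 2 * k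
nonIsolated-count {k} {c} H (f , f-surj , f-comps) T T-nonIsolated = begin
  ∑[ i < k ] 𝟙 (T i) + 2 * c            ≡⟨ +-comm _ (2 * c) ⟩
  2 * c + ∑[ i < k ] 𝟙 (T i)            ≡⟨ cong₂ _+_ (trans (*-comm 2 c) (sym (∑-const c 2)))
                                                      (sym (∑-fibreSum (𝟙 ∘ T))) ⟩
  ∑[ x < c ] 2 + ∑[ x < c ] marked x    ≡⟨ ∑-distrib-+ (λ _ → 2) marked ⟨
  ∑[ x < c ] (2 + marked x)             ≤⟨ ∑-mono-≤ component-bound ⟩
  ∑[ x < c ] (2 * size x)               ≡⟨ *-distribˡ-sum 2 size ⟨
  2 * ∑[ x < c ] size x                 ≡⟨ cong (2 *_) size-total ⟩
  2 * k                                 ∎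
  where
  open ≤-Reasoning
  open Fibres f

  size marked : Fin c → ℕ
  size = fibreSum (λ _ → 1)
  marked = fibreSum (𝟙 ∘ T)

  size-total : ∑[ x < c ] size x ≡ k
  size-total = trans (∑-fibreSum (λ _ → 1)) (trans (∑-const k 1) (*-identityʳ k))

  component-bound : ∀ x → 2 + marked x ≤ 2 * size x
  component-bound x with any? (λ i → f i ≟ x ×-dec T i Bool.≟ true)
  ... | no no-marked = begin
    2 + marked x  ≡⟨ cong (2 +_) (fibreSum-zero (𝟙 ∘ T) λ i fi≡x →
                                    𝟙-≢true (λ Ti → no-marked (i , fi≡x , Ti))) ⟩
    2 * 1         ≤⟨ *-monoʳ-≤ 2 (fibreSum-member (λ _ → 1) (proj₂ (f-surj x) refl)) ⟩
    2 * size x    ∎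
  ... | yes (i , fi≡x , Ti) with T-nonIsolated i Ti
  ...   | j , h , h∈H , hi , hj , i≢j = begin
    2 + marked x     ≤⟨ +-mono-≤ (fibreSum-pair (λ _ → 1) i≢j fi≡x fj≡x)
                                 (fibreSum-mono (𝟙≤1 ∘ T) x) ⟩
    size x + size x  ≡⟨ cong (size x +_) (+-identityʳ (size x)) ⟨
    2 * size x       ∎
    where
    fj≡x : f j ≡ x
    fj≡x = trans (sym (proj₂ (f-comps i j) (conn-step conn-refl h∈H hi hj))) fi≡x

part : ∀ {n k} → (Fin n → Fin k) → Fin k → Fin n → Bool
part p i v = ⌊ p v ≟ i ⌋

part-nonemptyProper : ∀ {n m} {p : Fin n → Fin (suc (suc m))} → Surjective _≡_ _≡_ p →
  ∀ i → NonemptyProper (part p i)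
part-nonemptyProper {p = p} p-surj i =
  (v , ⌊⌋-yes (p v ≟ i) (proj₂ (p-surj i) refl)) ,
  (u , ⌊⌋-no (p u ≟ i) (punchInᵢ≢i i zero ∘ trans (sym (proj₂ (p-surj (punchIn i zero)) refl))))
  where
  v u : Fin _
  v = proj₁ (p-surj i)
  u = proj₁ (p-surj (punchIn i zero))

inCut-part⇒nonIsolated : ∀ {n k} (p : Fin n → Fin k) (e : Hedge n) i →
  inCut (part p i) e ≡ true → NonIsolated (contract p e) i
inCut-part⇒nonIsolated p e i e∈δ
  with h , h∈e , h-crosses ← any-true⁻ (crosses (part p i)) e e∈δ
  with inside , outside ← ∧-true⁻ {anyV (λ v → h v ∧ part p i v)} h-crosses
  with v , hv∧pv≡i ← anyV-true⁻ _ inside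
  with u , hu∧pu≢i ← anyV-true⁻ _ outside
  with hv , pv≡i ← ∧-true⁻ {h v} hv∧pv≡i
  with hu , pu≢i ← ∧-true⁻ {h u} hu∧pu≢i =
  p u , contractEdge p h , ∈-map⁺ (contractEdge p) h∈e ,
  contractEdge-true p h hv (toWitness (from T-≡ pv≡i)) ,
  contractEdge-true p h hu refl ,
  toWitnessFalse (from T-≡ pu≢i) ∘ sym

∑-inCut-part≤2*[k∸c] : ∀ {n k c} (p : Fin n → Fin k) (e : Hedge n) → NumComps (contract p e) c →
  ∑[ i < k ] 𝟙 (inCut (part p i) e) ≤ 2 * (k ∸ c)
∑-inCut-part≤2*[k∸c] {k = k} {c} p e comps =
  subst (cut-parts ≤_) (sym (*-distribˡ-∸ 2 k c))
    (m+n≤o⇒m≤o∸n cut-parts (nonIsolated-count (contract p e) comps (λ i → inCut (part p i) e)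
                                                (inCut-part⇒nonIsolated p e)))
  where
  cut-parts : ℕ
  cut-parts = ∑[ i < k ] 𝟙 (inCut (part p i) e)

[2+m]*l≤2*s⇒l/2≤s/[1+m] : ∀ m l s → suc (suc m) * l ≤ 2 * s → l / 2 ≤ s / suc m
[2+m]*l≤2*s⇒l/2≤s/[1+m] m l s [2+m]*l≤2*s = begin
  l / 2                  ≡⟨ m*n/n≡m (l / 2) (suc m) ⟨
  l / 2 * suc m / suc m  ≤⟨ /-monoˡ-≤ (suc m) (*-cancelˡ-≤ {l / 2 * suc m} {s} 2 twice≤) ⟩
  s / suc m              ∎
  where
  open ≤-Reasoning
  twice≤ : 2 * (l / 2 * suc m) ≤ 2 * s
  twice≤ = begin
    2 * (l / 2 * suc m)  ≡⟨ *-assoc 2 (l / 2) (suc m) ⟨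
    2 * (l / 2) * suc m  ≡⟨ cong (_* suc m) (*-comm 2 (l / 2)) ⟩
    l / 2 * 2 * suc m    ≤⟨ *-monoˡ-≤ (suc m) (m/n*n≤m l 2) ⟩
    l * suc m            ≤⟨ *-monoʳ-≤ l (n≤1+n (suc m)) ⟩
    l * suc (suc m)      ≡⟨ *-comm l (suc (suc m)) ⟩
    suc (suc m) * l      ≤⟨ [2+m]*l≤2*s ⟩
    2 * s                ∎

wpc-lower-bound : ∀ {n l w} (E : Hedgegraph n) → (∀ S → NonemptyProper S → l ≤ cutSize E S) →
  PartitionValue E w → l / 2 ≤ w
wpc-lower-bound {l = l} E l≤cuts (m , p , p-surj , cs , cs-comps , refl) =
  subst (l / 2 ≤_) (cong (_/ suc m) (sym (sumFin≡∑ (λ a → k ∸ cs a))))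
    ([2+m]*l≤2*s⇒l/2≤s/[1+m] m l (∑[ a < length E ] (k ∸ cs a)) (begin
      k * l                                                 ≡⟨ ∑-const k l ⟨
      ∑[ i < k ] l                                          ≤⟨ ∑-mono-≤ l≤cut-part ⟩
      ∑[ i < k ] cutSize E (part p i)                       ≡⟨ sum-cong-≗ (cutSize≡∑ E ∘ part p) ⟩
      ∑[ i < k ] ∑[ a < length E ] inCut-part i a           ≡⟨ ∑-comm inCut-part ⟩
      ∑[ a < length E ] ∑[ i < k ] inCut-part i a           ≤⟨ ∑-mono-≤ parts-cut-by ⟩
      ∑[ a < length E ] (2 * (k ∸ cs a))                    ≡⟨ *-distribˡ-sum 2 (λ a → k ∸ cs a) ⟨
      2 * ∑[ a < length E ] (k ∸ cs a)                      ∎))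
  where
  open ≤-Reasoning
  k : ℕ
  k = suc (suc m)

  inCut-part : Fin k → Fin (length E) → ℕ
  inCut-part i a = 𝟙 (inCut (part p i) (lookup E a))

  l≤cut-part : ∀ i → l ≤ cutSize E (part p i)
  l≤cut-part i = l≤cuts (part p i) (part-nonemptyProper p-surj i)

  parts-cut-by : ∀ a → ∑[ i < k ] inCut-part i a ≤ 2 * (k ∸ cs a)
  parts-cut-by a = ∑-inCut-part≤2*[k∸c] p (lookup E a) (cs-comps a)

joins : Hyperedge 2 → Bool
joins h = h zero ∧ h (suc zero)

numComps-Fin2 : (H : List (Hyperedge 2)) → NumComps H (if any joins H then 1 else 2)
numComps-Fin2 H with any joins H in any-joins
... | true with h , h∈H , h-joins ← any-true⁻ joins H any-joins
           with h0 , h1 ← ∧-true⁻ {h zero} h-joins =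
  (λ _ → zero) , (λ { zero → zero , λ _ → refl }) , λ i j → (λ _ → connected i j) , (λ _ → refl)
  where
  connected : ∀ i j → Conn H i j
  connected zero zero = conn-refl
  connected zero (suc zero) = conn-step conn-refl h∈H h0 h1
  connected (suc zero) zero = conn-step conn-refl h∈H h1 h0
  connected (suc zero) (suc zero) = conn-refl
... | false =
  id , (λ x → x , λ z≡x → z≡x) , λ i j → (λ i≡j → subst (Conn H i) i≡j conn-refl) , conn⇒≡
  where
  no-join : ∀ {h} → h ∈ H → h zero ≡ true → h (suc zero) ≡ true → ⊥
  no-join h∈H h0 h1 with () ← trans (sym any-joins) (any-true⁺ joins h∈H (∧-true⁺ h0 h1))

  same-vertex : ∀ {h i j} → h ∈ H → h i ≡ true → h j ≡ true → i ≡ j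
  same-vertex {i = zero} {zero} _ _ _ = refl
  same-vertex {i = zero} {suc zero} h∈H hi hj = ⊥-elim (no-join h∈H hi hj)
  same-vertex {i = suc zero} {zero} h∈H hi hj = ⊥-elim (no-join h∈H hj hi)
  same-vertex {i = suc zero} {suc zero} _ _ _ = refl

  conn⇒≡ : ∀ {i j} → Conn H i j → i ≡ j
  conn⇒≡ conn-refl = refl
  conn⇒≡ (conn-step c h∈H hj hl) = trans (conn⇒≡ c) (same-vertex h∈H hj hl)

bipartition : ∀ {n} → (Fin n → Bool) → Fin n → Fin 2
bipartition S v = if S v then zero else suc zero

crosses≡joins-bipartition : ∀ {n} (S : Fin n → Bool) h →
  crosses S h ≡ joins (contractEdge (bipartition S) h)
crosses≡joins-bipartition S h =
  cong₂ _∧_ (anyV-cong (λ v → cong (h v ∧_) (inside v)))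
            (anyV-cong (λ v → cong (h v ∧_) (outside v)))
  where
  inside : ∀ v → S v ≡ part (bipartition S) zero v
  inside v with S v
  ... | true = refl
  ... | false = refl

  outside : ∀ v → not (S v) ≡ part (bipartition S) (suc zero) v
  outside v with S v
  ... | true = refl
  ... | false = refl

inCut≡any-joins : ∀ {n} (S : Fin n → Bool) e → inCut S e ≡ any joins (contract (bipartition S) e)
inCut≡any-joins S e = cong or (trans (map-cong (crosses≡joins-bipartition S) e) (map-∘ e))

cutSize-partitionValue : ∀ {n} (E : Hedgegraph n) S → NonemptyProper S →
  PartitionValue E (cutSize E S)
cutSize-partitionValue E S ((v , Sv) , (u , Su)) =
  0 , bipartition S , surj , comps , (λ a → numComps-Fin2 (contract (bipartition S) (lookup E a))) ,
  value
  where
  open ≡-Reasoning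

  surj : Surjective _≡_ _≡_ (bipartition S)
  surj zero = v , λ { refl → cong (if_then zero else suc zero) Sv }
  surj (suc zero) = u , λ { refl → cong (if_then zero else suc zero) Su }

  comps : Fin (length E) → ℕ
  comps a = if any joins (contract (bipartition S) (lookup E a)) then 1 else 2

  𝟙≡2∸if : ∀ b → 𝟙 b ≡ 2 ∸ (if b then 1 else 2)
  𝟙≡2∸if true = refl
  𝟙≡2∸if false = refl

  𝟙-inCut≡2∸comps : ∀ a → 𝟙 (inCut S (lookup E a)) ≡ 2 ∸ comps a
  𝟙-inCut≡2∸comps a = trans (cong 𝟙 (inCut≡any-joins S (lookup E a))) (𝟙≡2∸if _)

  value : cutSize E S ≡ sumFin (λ a → 2 ∸ comps a) / 1
  value = begin
    cutSize E S                                 ≡⟨ cutSize≡∑ E S ⟩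
    ∑[ a < length E ] 𝟙 (inCut S (lookup E a))  ≡⟨ sum-cong-≗ 𝟙-inCut≡2∸comps ⟩
    ∑[ a < length E ] (2 ∸ comps a)             ≡⟨ sumFin≡∑ (λ a → 2 ∸ comps a) ⟨
    sumFin (λ a → 2 ∸ comps a)                  ≡⟨ n/1≡n _ ⟨
    sumFin (λ a → 2 ∸ comps a) / 1              ∎

lemma1p6 : (n : ℕ) → 2 ≤ n → (E : Hedgegraph n) → IsHedgegraph E →
    (l w : ℕ) → IsConnectivity E l → IsWPC E w → 0 < l →
    (l / 2 ≤ w) × (w ≤ l)
lemma1p6 n _ E _ l w ((S , S-proper , cut≡l) , l≤cuts) (w-value , w≤values) _ =
  wpc-lower-bound E l≤cuts w-value ,
  subst (w ≤_) cut≡l (w≤values (cutSize E S) (cutSize-partitionValue E S S-proper))
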